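{- If $U$ is a consistent subset of $D$, then both $G(U)$ and $F(U)$ are consistent.
   Context: $L$ is an MA (mathematically agreeable) language: its syntax contains a countable syntax of first-order predicate logic with equality, with natural numbers and numerals as terms; $L$ is fully interpreted (each sentence of $L$ is either true or false, not both); classical truth tables hold for $\neg,\vee,\wedge,\rightarrow,\leftrightarrow$ on sentences of $L$; classical truth rules hold for $\forall xP(x)$, $\exists xP(x)$. $T$ is a monadic predicate letter not in $L$. $\mathcal L$ has as basic sentences the sentences of $L$, $T(\mathbf n)$ for numerals $\mathbf n$, and $\forall xT(x)$, $\exists xT(x)$, $\forall x\neg T(x)$, $\exists x\neg T(x)$, and is closed under $\neg,\vee,\wedge,\rightarrow,\leftrightarrow$. With a fixed Gödel numbering, $\#A$ is the Gödel number of $A$, $\lceil A\rceil$ its numeral; $D$ is the set of Gödel numbers of sentences of $\mathcal L$; $W$ the set of Gödel numbers of true sentences of $L$. A set $U\subseteq D$ is consistent if no sentence $A$ of $\mathcal L$ has both $\#A\in U$ and $\#[\neg A]\in U$. For $U\subseteq D$: $D_1(U)=\{\#T(\mathbf n):\mathbf n=\lceil A\rceil,\ \#A\in U\}$, $D_2(U)=\{\#[\neg T(\mathbf n)]:\mathbf n=\lceil A\rceil,\ \#[\neg A]\in U\}$. $G_0(U)=W$ if $U=\emptyset$; $=W\cup D_1(U)\cup\{\#[\exists xT(x)],\#[\neg\forall x\neg T(x)]\}$ if $\emptyset\subsetneq U\subsetneq D$ and $D_2(U)=\emptyset$; $=W\cup D_1(U)\cup D_2(U)\cup\{\#[\exists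 xT(x)],\#[\neg\forall x\neg T(x)],\#[\neg\forall xT(x)],\#[\exists x\neg T(x)]\}$ if $\emptyset\subsetneq U\subsetneq D$ and $D_2(U)\neq\emptyset$; $=W\cup D_1(U)\cup D_2(U)\cup\{\#[\exists xT(x)],\#[\neg\exists xT(x)],\#[\forall xT(x)],\#[\neg\forall xT(x)],\#[\forall x\neg T(x)],\#[\neg\forall x\neg T(x)],\#[\exists x\neg T(x)],\#[\neg\exists x\neg T(x)]\}$ if $U=D$. $G_{n+1}(U)$ is $G_n(U)$ together with: $\#[A\vee B]$ when $\#A$ or $\#B\in G_n(U)$; $\#[A\wedge B]$ when $\#A,\#B\in G_n(U)$; $\#[A\rightarrow B]$ when $\#[\neg A]$ or $\#B\in G_n(U)$; $\#[A\leftrightarrow B]$ when both $\#A,\#B$ or both $\#[\neg A],\#[\neg B]$ are in $G_n(U)$; $\#[\neg(A\vee B)]$ when $\#[\neg A],\#[\neg B]\in G_n(U)$; $\#[\neg(A\wedge B)]$ when $\#[\neg A]$ or $\#[\neg B]\in G_n(U)$; $\#[\neg(A\rightarrow B)]$ when $\#A,\#[\neg B]\in G_n(U)$; $\#[\neg(A\leftrightarrow B)]$ when both $\#A,\#[\neg B]$ or both $\#[\neg A],\#B$ are in $G_n(U)$; $\#[\neg(\neg A)]$ when $\#A\in G_n(U)$ ($A,B$ sentences of $\mathcal L$). $G(U)=\bigcup_{n\ge0}G_n(U)$, $F(U)=\{\#A:\#[\neg A]\in G(U)\}$. -}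

module Defs where

open import Data.Nat using (ℕ)
open import Data.Bool using (Bool; true; false; not; _∧_; _∨_; if_then_else_)
open import Data.Product using (Σ; _×_; _,_)
open import Data.Sum using (_⊎_)
open import Relation.Nullary using (¬_)
open import Relation.Binary.PropositionalEquality using (_≡_)
open import Function.Definitions using (Injective)

-- Sentences of 𝓛 over a type P of "prime" sentences of L, i.e. sentences of L
-- that are not built by a propositional connective at the top
-- (atomic sentences and quantified sentences of L).  Every sentence of L is
-- uniquely a connective combination of prime L-sentences; the sentences of 𝓛
-- are connective combinations of prime L-sentences and the basic sentences
-- T(n), ∀xT(x), ∃xT(x), ∀x¬T(x), ∃x¬T(x).
infixr 6 _∨ˢ_
infixr 7 _∧ˢ_
infixr 5 _⇒ˢ_ _⇔ˢ_

data Sen (P : Set) : Set where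
  prime : P → Sen P
  T     : ℕ → Sen P
  ∀T    : Sen P
  ∃T    : Sen P
  ∀¬T   : Sen P
  ∃¬T   : Sen P
  ¬ˢ_   : Sen P → Sen P
  _∨ˢ_  : Sen P → Sen P → Sen P
  _∧ˢ_  : Sen P → Sen P → Sen P
  _⇒ˢ_  : Sen P → Sen P → Sen P
  _⇔ˢ_  : Sen P → Sen P → Sen P

data IsL {P : Set} : Sen P → Set where
  prime : ∀ p → IsL (prime p)
  neg   : ∀ {A} → IsL A → IsL (¬ˢ A)
  or    : ∀ {A B} → IsL A → IsL B → IsL (A ∨ˢ B)
  and   : ∀ {A B} → IsL A → IsL B → IsL (A ∧ˢ B)
  imp   : ∀ {A B} → IsL A → IsL B → IsL (A ⇒ˢ B)
  iff   : ∀ {A B} → IsL A → IsL B → IsL (A ⇔ˢ B)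

-- The interpretation assigns a truth value to each prime L-sentence; truth of
-- the other L-sentences is given by the classical truth tables (below).
record MALang : Set₁ where
  field
    Prime     : Set
    valPrime  : Prime → Bool
    code      : Sen Prime → ℕ
    code-inj  : Injective _≡_ _≡_ code

module _ (ℒ : MALang) where
  open MALang ℒ

  S : Set
  S = Sen Prime

  val : (A : S) → IsL A → Bool
  val (prime p) (prime .p) = valPrime p
  val (¬ˢ A) (neg a) = not (val A a)
  val (A ∨ˢ B) (or a b) = val A a ∨ val B b
  val (A ∧ˢ B) (and a b) = val A a ∧ val B b
  val (A ⇒ˢ B) (imp a b) = not (val A a) ∨ val B b
  val (A ⇔ˢ B) (iff a b) = if val A a then val B b else not (val B b)

  Pred : Set₁
  Pred = ℕ → Set

  _⊆_ : Pred → Pred → Set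
  X ⊆ Y = ∀ m → X m → Y m

  D : Pred
  D m = Σ S λ A → code A ≡ m

  W : Pred
  W m = Σ S λ A → Σ (IsL A) λ a → (code A ≡ m) × (val A a ≡ true)

  Consistent : Pred → Set
  Consistent U = ∀ (A : S) → ¬ (U (code A) × U (code (¬ˢ A)))

  D₁ : Pred → Pred
  D₁ U m = Σ S λ A → U (code A) × (m ≡ code (T (code A)))

  D₂ : Pred → Pred
  D₂ U m = Σ S λ A → U (code (¬ˢ A)) × (m ≡ code (¬ˢ T (code A)))

  Empty : Pred → Set
  Empty X = ∀ m → ¬ X m

  ProperNonempty : Pred → Set
  ProperNonempty U = ¬ Empty U × (U ⊆ D) × ¬ (D ⊆ U)

  SameSet : Pred → Pred → Set
  SameSet X Y = X ⊆ Y × Y ⊆ X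

  data ExtraA (m : ℕ) : Set where
    e∃T   : m ≡ code ∃T → ExtraA m
    e¬∀¬T : m ≡ code (¬ˢ ∀¬T) → ExtraA m

  data ExtraB (m : ℕ) : Set where
    e∃T   : m ≡ code ∃T → ExtraB m
    e¬∀¬T : m ≡ code (¬ˢ ∀¬T) → ExtraB m
    e¬∀T  : m ≡ code (¬ˢ ∀T) → ExtraB m
    e∃¬T  : m ≡ code ∃¬T → ExtraB m

  data ExtraC (m : ℕ) : Set where
    e∃T   : m ≡ code ∃T → ExtraC m
    e¬∃T  : m ≡ code (¬ˢ ∃T) → ExtraC m
    e∀T   : m ≡ code ∀T → ExtraC m
    e¬∀T  : m ≡ code (¬ˢ ∀T) → ExtraC m
    e∀¬T  : m ≡ code ∀¬T → ExtraC m
    e¬∀¬T : m ≡ code (¬ˢ ∀¬T) → ExtraC m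
    e∃¬T  : m ≡ code ∃¬T → ExtraC m
    e¬∃¬T : m ≡ code (¬ˢ ∃¬T) → ExtraC m

  G₀ : Pred → Pred
  G₀ U m =
      (Empty U × W m)
    ⊎ ((ProperNonempty U × Empty (D₂ U)) × (W m ⊎ D₁ U m ⊎ ExtraA m))
    ⊎ ((ProperNonempty U × ¬ Empty (D₂ U)) × (W m ⊎ D₁ U m ⊎ D₂ U m ⊎ ExtraB m))
    ⊎ (SameSet U D × (W m ⊎ D₁ U m ⊎ D₂ U m ⊎ ExtraC m))

  data Step (X : Pred) : Pred where
    s∨  : ∀ A B → X (code A) ⊎ X (code B) → Step X (code (A ∨ˢ B))
    s∧  : ∀ A B → X (code A) → X (code B) → Step X (code (A ∧ˢ B))
    s⇒  : ∀ A B → X (code (¬ˢ A)) ⊎ X (code B) → Step X (code (A ⇒ˢ B))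
    s⇔  : ∀ A B → (X (code A) × X (code B)) ⊎ (X (code (¬ˢ A)) × X (code (¬ˢ B)))
          → Step X (code (A ⇔ˢ B))
    s¬∨ : ∀ A B → X (code (¬ˢ A)) → X (code (¬ˢ B)) → Step X (code (¬ˢ (A ∨ˢ B)))
    s¬∧ : ∀ A B → X (code (¬ˢ A)) ⊎ X (code (¬ˢ B)) → Step X (code (¬ˢ (A ∧ˢ B)))
    s¬⇒ : ∀ A B → X (code A) → X (code (¬ˢ B)) → Step X (code (¬ˢ (A ⇒ˢ B)))
    s¬⇔ : ∀ A B → (X (code A) × X (code (¬ˢ B))) ⊎ (X (code (¬ˢ A)) × X (code B))
          → Step X (code (¬ˢ (A ⇔ˢ B)))
    s¬¬ : ∀ A → X (code A) → Step X (code (¬ˢ (¬ˢ A)))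

  Gₙ : ℕ → Pred → Pred
  Gₙ ℕ.zero U = G₀ U
  Gₙ (ℕ.suc n) U m = Gₙ n U m ⊎ Step (Gₙ n U) m

  G : Pred → Pred
  G U m = Σ ℕ λ n → Gₙ n U m

  F : Pred → Pred
  F U m = Σ S λ A → (m ≡ code A) × G U (code (¬ˢ A))

module Submission where

-- The closure steps G_n ↦ G_{n+1} are exactly the strong-Kleene rules
-- for verifying a sentence (or its negation) from verified parts.  So fix a
-- set X of sentences and say that A is *verified* (resp. *refuted*) over X
-- when it is by the strong-Kleene clauses, the atoms (prime L-sentences and
-- the basic T-sentences) being verified when in X and refuted when their
-- negation is in X.  Three general facts follow by induction on sentences
-- and on n:
--   * if X is consistent on atoms, no sentence is both verified and refuted;
--   * if X agrees with the interpretation on prime sentences, every sentence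
--     of L is verified or refuted according to its truth value;
--   * if every member of G₀(U) is verified over X, so is every member of G(U).
-- For consistent U we then take for X the sentences of the shapes that make
-- up G₀(U) (the case U = D cannot occur); this X is consistent on atoms and
-- verifies G₀(U), so G(U) is consistent, and F(U) inherits consistency.

open import Defs
open import Data.Nat using (ℕ; zero; suc)
open import Data.Bool using (Bool; true; false; not)
open import Data.Bool.Properties using (not-¬)
open import Data.Product using (Σ; _×_; _,_; map; map₂)
open import Data.Sum using (_⊎_; inj₁; inj₂; [_,_]′) renaming (map to ⊎-map)
open import Data.Empty using (⊥; ⊥-elim)
open import Relation.Nullary using (¬_)
open import Relation.Binary.PropositionalEquality using (_≡_; refl; sym; trans; subst; cong)

module Verification (ℒ : MALang) where
  open MALang ℒ

  data Atom : S ℒ → Set where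
    isPrime : ∀ p → Atom (prime p)
    isT     : ∀ k → Atom (T k)
    is∀T    : Atom ∀T
    is∃T    : Atom ∃T
    is∀¬T   : Atom ∀¬T
    is∃¬T   : Atom ∃¬T

  Verified Refuted : (S ℒ → Set) → S ℒ → Set
  Verified X (prime p) = X (prime p)
  Verified X (T k)     = X (T k)
  Verified X ∀T        = X ∀T
  Verified X ∃T        = X ∃T
  Verified X ∀¬T       = X ∀¬T
  Verified X ∃¬T       = X ∃¬T
  Verified X (¬ˢ A)    = Refuted X A
  Verified X (A ∨ˢ B)  = Verified X A ⊎ Verified X B
  Verified X (A ∧ˢ B)  = Verified X A × Verified X B
  Verified X (A ⇒ˢ B)  = Refuted X A ⊎ Verified X B
  Verified X (A ⇔ˢ B)  = (Verified X A × Verified X B) ⊎ (Refuted X A × Refuted X B)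
  Refuted X (prime p)  = X (¬ˢ prime p)
  Refuted X (T k)      = X (¬ˢ T k)
  Refuted X ∀T         = X (¬ˢ ∀T)
  Refuted X ∃T         = X (¬ˢ ∃T)
  Refuted X ∀¬T        = X (¬ˢ ∀¬T)
  Refuted X ∃¬T        = X (¬ˢ ∃¬T)
  Refuted X (¬ˢ A)     = Verified X A
  Refuted X (A ∨ˢ B)   = Refuted X A × Refuted X B
  Refuted X (A ∧ˢ B)   = Refuted X A ⊎ Refuted X B
  Refuted X (A ⇒ˢ B)   = Verified X A × Refuted X B
  Refuted X (A ⇔ˢ B)   = (Verified X A × Refuted X B) ⊎ (Refuted X A × Verified X B)

  AtomConsistent : (S ℒ → Set) → Set
  AtomConsistent X = ∀ {A} → Atom A → X A → X (¬ˢ A) → ⊥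

  disjoint : ∀ {X} → AtomConsistent X → ∀ A → Verified X A → Refuted X A → ⊥
  disjoint ac (prime p) = ac (isPrime p)
  disjoint ac (T k)     = ac (isT k)
  disjoint ac ∀T        = ac is∀T
  disjoint ac ∃T        = ac is∃T
  disjoint ac ∀¬T       = ac is∀¬T
  disjoint ac ∃¬T       = ac is∃¬T
  disjoint ac (¬ˢ A) v r = disjoint ac A r v
  disjoint ac (A ∨ˢ B) (inj₁ v) (r , _) = disjoint ac A v r
  disjoint ac (A ∨ˢ B) (inj₂ v) (_ , r) = disjoint ac B v r
  disjoint ac (A ∧ˢ B) (v , _) (inj₁ r) = disjoint ac A v r
  disjoint ac (A ∧ˢ B) (_ , v) (inj₂ r) = disjoint ac B v r
  disjoint ac (A ⇒ˢ B) (inj₁ r) (v , _) = disjoint ac A v r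
  disjoint ac (A ⇒ˢ B) (inj₂ v) (_ , r) = disjoint ac B v r
  disjoint ac (A ⇔ˢ B) (inj₁ (_ , v)) (inj₁ (_ , r)) = disjoint ac B v r
  disjoint ac (A ⇔ˢ B) (inj₁ (v , _)) (inj₂ (r , _)) = disjoint ac A v r
  disjoint ac (A ⇔ˢ B) (inj₂ (r , _)) (inj₁ (v , _)) = disjoint ac A v r
  disjoint ac (A ⇔ˢ B) (inj₂ (_ , r)) (inj₂ (_ , v)) = disjoint ac B v r

  Verdict : (S ℒ → Set) → Bool → S ℒ → Set
  Verdict X true  A = Verified X A
  Verdict X false A = Refuted X A

  PrimesDecided : (S ℒ → Set) → Set
  PrimesDecided X = ∀ p → Verdict X (valPrime p) (prime p)

  truth-lemma : ∀ {X} → PrimesDecided X → ∀ A (a : IsL A) → Verdict X (val ℒ A a) A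
  truth-lemma d (prime p) (prime .p) = d p
  truth-lemma d (¬ˢ A) (neg a) with val ℒ A a | truth-lemma d A a
  ... | true  | v = v
  ... | false | r = r
  truth-lemma d (A ∨ˢ B) (or a b)
    with val ℒ A a | truth-lemma d A a | val ℒ B b | truth-lemma d B b
  ... | true  | v | _     | _  = inj₁ v
  ... | false | _ | true  | v  = inj₂ v
  ... | false | r | false | r′ = r , r′
  truth-lemma d (A ∧ˢ B) (and a b)
    with val ℒ A a | truth-lemma d A a | val ℒ B b | truth-lemma d B b
  ... | true  | v | true  | v′ = v , v′
  ... | true  | _ | false | r  = inj₂ r
  ... | false | r | _     | _  = inj₁ r
  truth-lemma d (A ⇒ˢ B) (imp a b)
    with val ℒ A a | truth-lemma d A a | val ℒ B b | truth-lemma d B b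
  ... | true  | _ | true  | v  = inj₂ v
  ... | true  | v | false | r  = v , r
  ... | false | r | _     | _  = inj₁ r
  truth-lemma d (A ⇔ˢ B) (iff a b)
    with val ℒ A a | truth-lemma d A a | val ℒ B b | truth-lemma d B b
  ... | true  | v | true  | v′ = inj₁ (v , v′)
  ... | true  | v | false | r  = inj₁ (v , r)
  ... | false | r | true  | v  = inj₂ (r , v)
  ... | false | r | false | r′ = inj₂ (r , r′)

  Certified : (S ℒ → Set) → Pred ℒ
  Certified X m = Σ (S ℒ) λ A → (m ≡ code A) × Verified X A

  verified-at : ∀ {X A} → Certified X (code A) → Verified X A
  verified-at (_ , e , v) with code-inj e
  ... | refl = v

  -- One closure step preserves certification: Step is strong-Kleene verification.
  step-certified : ∀ {X Y} → _⊆_ ℒ Y (Certified X) → _⊆_ ℒ (Step ℒ Y) (Certified X)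
  step-certified {X} {Y} c _ step = certify step
    where
    v : ∀ {A} → Y (code A) → Verified X A
    v y = verified-at (c _ y)

    certify : ∀ {m} → Step ℒ Y m → Certified X m
    certify (s∨ A B h)     = A ∨ˢ B , refl , ⊎-map v v h
    certify (s∧ A B h h′)  = A ∧ˢ B , refl , v h , v h′
    certify (s⇒ A B h)     = A ⇒ˢ B , refl , ⊎-map v v h
    certify (s⇔ A B h)     = A ⇔ˢ B , refl , ⊎-map (map v v) (map v v) h
    certify (s¬∨ A B h h′) = ¬ˢ (A ∨ˢ B) , refl , v h , v h′
    certify (s¬∧ A B h)    = ¬ˢ (A ∧ˢ B) , refl , ⊎-map v v h
    certify (s¬⇒ A B h h′) = ¬ˢ (A ⇒ˢ B) , refl , v h , v h′
    certify (s¬⇔ A B h)    = ¬ˢ (A ⇔ˢ B) , refl , ⊎-map (map v v) (map v v) h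
    certify (s¬¬ A h)      = ¬ˢ (¬ˢ A) , refl , v h

  Gₙ-certified : ∀ {X U} → _⊆_ ℒ (G₀ ℒ U) (Certified X)
    → ∀ n → _⊆_ ℒ (Gₙ ℒ n U) (Certified X)
  Gₙ-certified c zero = c
  Gₙ-certified c (suc n) m (inj₁ g) = Gₙ-certified c n m g
  Gₙ-certified c (suc n) m (inj₂ s) = step-certified (Gₙ-certified c n) m s

  G-certified : ∀ {X U} → _⊆_ ℒ (G₀ ℒ U) (Certified X) → _⊆_ ℒ (G ℒ U) (Certified X)
  G-certified c m (n , g) = Gₙ-certified c n m g

  certified-consistent : ∀ {X Y} → AtomConsistent X → _⊆_ ℒ Y (Certified X)
    → Consistent ℒ Y
  certified-consistent ac c A (y , y′) =
    disjoint ac A (verified-at (c _ y)) (verified-at (c _ y′))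

  -- #A ∈ F(U) and #¬A ∈ F(U) would put both #¬A and #¬¬A into G(U).
  F-consistent : ∀ U → Consistent ℒ (G ℒ U) → Consistent ℒ (F ℒ U)
  F-consistent U gc A ((A₁ , e₁ , g₁) , (A₂ , e₂ , g₂))
    with code-inj e₁ | code-inj e₂
  ... | refl | refl = gc (¬ˢ A) (g₁ , g₂)

  -- A consistent set cannot contain all of D (it would contain #∀xT(x), #¬∀xT(x)).
  consistent-not-full : ∀ {U} → Consistent ℒ U → ¬ (_⊆_ ℒ (D ℒ) U)
  consistent-not-full cons full = cons ∀T (full _ (∀T , refl) , full _ (¬ˢ ∀T , refl))

module InitialStage (ℒ : MALang) (U : Pred ℒ) (cons : Consistent ℒ U) where
  open MALang ℒ
  open Verification ℒ

  data G₀Shape : S ℒ → Set where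
    true-L        : ∀ {A} (a : IsL A) → val ℒ A a ≡ true → G₀Shape A
    in-D₁         : ∀ {k} B → U (code B) → k ≡ code B → G₀Shape (T k)
    in-D₂         : ∀ {k} B → U (code (¬ˢ B)) → k ≡ code B → G₀Shape (¬ˢ T k)
    exists-T      : G₀Shape ∃T
    not-all-not-T : G₀Shape (¬ˢ ∀¬T)
    not-all-T     : G₀Shape (¬ˢ ∀T)
    exists-not-T  : G₀Shape ∃¬T

  Shaped : Pred ℒ
  Shaped m = Σ (S ℒ) λ A → (m ≡ code A) × G₀Shape A

  from-W : _⊆_ ℒ (W ℒ) Shaped
  from-W _ (A , a , e , v) = A , sym e , true-L a v

  from-D₁ : _⊆_ ℒ (D₁ ℒ U) Shaped
  from-D₁ _ (B , u , e) = T (code B) , e , in-D₁ B u refl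

  from-D₂ : _⊆_ ℒ (D₂ ℒ U) Shaped
  from-D₂ _ (B , u , e) = ¬ˢ T (code B) , e , in-D₂ B u refl

  from-ExtraA : _⊆_ ℒ (ExtraA ℒ) Shaped
  from-ExtraA _ (e∃T e)   = ∃T , e , exists-T
  from-ExtraA _ (e¬∀¬T e) = ¬ˢ ∀¬T , e , not-all-not-T

  from-ExtraB : _⊆_ ℒ (ExtraB ℒ) Shaped
  from-ExtraB _ (e∃T e)   = ∃T , e , exists-T
  from-ExtraB _ (e¬∀¬T e) = ¬ˢ ∀¬T , e , not-all-not-T
  from-ExtraB _ (e¬∀T e)  = ¬ˢ ∀T , e , not-all-T
  from-ExtraB _ (e∃¬T e)  = ∃¬T , e , exists-not-T

  G₀-shaped : _⊆_ ℒ (G₀ ℒ U) Shaped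
  G₀-shaped m (inj₁ (_ , w)) = from-W m w
  G₀-shaped m (inj₂ (inj₁ (_ , x))) =
    [ from-W m , [ from-D₁ m , from-ExtraA m ]′ ]′ x
  G₀-shaped m (inj₂ (inj₂ (inj₁ (_ , x)))) =
    [ from-W m , [ from-D₁ m , [ from-D₂ m , from-ExtraB m ]′ ]′ ]′ x
  G₀-shaped m (inj₂ (inj₂ (inj₂ ((_ , full) , _)))) =
    ⊥-elim (consistent-not-full cons full)

  shapes-decide-primes : PrimesDecided G₀Shape
  shapes-decide-primes p with valPrime p in e
  ... | true  = true-L (prime p) e
  ... | false = true-L (neg (prime p)) (cong not e)

  -- Each shape is verified over the shapes: true L-sentences by the truth
  -- lemma, the others because they are atoms or negated atoms.
  shape-verified : ∀ {A} → G₀Shape A → Verified G₀Shape A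
  shape-verified {A} (true-L a v) =
    subst (λ b → Verdict G₀Shape b A) v (truth-lemma shapes-decide-primes A a)
  shape-verified s@(in-D₁ _ _ _) = s
  shape-verified s@(in-D₂ _ _ _) = s
  shape-verified exists-T        = exists-T
  shape-verified not-all-not-T   = not-all-not-T
  shape-verified not-all-T       = not-all-T
  shape-verified exists-not-T    = exists-not-T

  G₀-certified : _⊆_ ℒ (G₀ ℒ U) (Certified G₀Shape)
  G₀-certified m g = map₂ (map₂ shape-verified) (G₀-shaped m g)

  -- The shapes are atom-consistent: a prime sentence and its negation cannot
  -- both be true, T(#B) and ¬T(#B) would need #B, #¬B ∈ U, and the remaining
  -- atoms never occur together with their negations.
  shapes-atom-consistent : AtomConsistent G₀Shape
  shapes-atom-consistent (isPrime p) (true-L (prime .p) v) (true-L (neg (prime .p)) v′) =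
    not-¬ (sym v) (sym v′)
  shapes-atom-consistent (isT k) (true-L () _) _
  shapes-atom-consistent (isT k) (in-D₁ _ _ _) (true-L (neg ()) _)
  shapes-atom-consistent (isT k) (in-D₁ B u e) (in-D₂ B′ u′ e′)
    with code-inj (trans (sym e) e′)
  ... | refl = cons B (u , u′)
  shapes-atom-consistent is∀T (true-L () _) _
  shapes-atom-consistent is∃T _ (true-L (neg ()) _)
  shapes-atom-consistent is∀¬T (true-L () _) _
  shapes-atom-consistent is∃¬T _ (true-L (neg ()) _)

  G-consistent : Consistent ℒ (G ℒ U)
  G-consistent = certified-consistent shapes-atom-consistent (G-certified G₀-certified)

lemma4p2 : (ℒ : MALang) (U : ℕ → Set) → _⊆_ ℒ U (D ℒ) → Consistent ℒ U
    → Consistent ℒ (G ℒ U) × Consistent ℒ (F ℒ U)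
lemma4p2 ℒ U _ cons = G-consistent , Verification.F-consistent ℒ U G-consistent
  where open InitialStage ℒ U cons
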